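{- Let $G=(V,E)$ be a connected unit interval graph and let $t\in V$. The following are equivalent: (i) $t$ is simplicial and $G-N[t]$ is connected; (ii) $t$ is the last vertex of some unit interval order of $G$; (iii) $t$ is the last vertex of some MNS ordering of $G$. Moreover, (iii) is also equivalent to each of: $t$ is the last vertex of some MCS ordering of $G$; $t$ is the last vertex of some LDFS ordering of $G$.
   Context: A unit interval graph is the intersection graph of a family of closed intervals of equal length on the real line. A unit interval order of $G$ is an ordering $\sigma$ of $V$ such that whenever $u\prec_\sigma v\prec_\sigma w$ and $uw\in E$, also $uv\in E$ and $vw\in E$. $N[t]=N(t)\cup\{t\}$; a vertex is simplicial if its neighbourhood is a clique. Let $n=|V|$. MNS: the first vertex is arbitrary; at each subsequent step the label of an unnumbered vertex is the set of positions of its already numbered neighbours, and one numbers next an unnumbered vertex whose label is maximal under set inclusion. MCS: the first vertex is arbitrary; at each subsequent step number next an unnumbered vertex with the largest number of already numbered neighbours. LDFS: the start vertex $s$ gets label $(0)$, all others the empty label; for $i=1,\dots,n$, number $i$ an unnumbered vertex $v$ with lexicographically largest label (a string of integers), then prepend $i$ to the label of every unnumbered neighbour of $v$. Ties are broken arbitrarily and an ordering of the search is any possible output.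
   Formalization: The intervals of equal length representing G have rational endpoints rather than arbitrary real ones. -}

module Defs where

open import Data.Nat using (ℕ; zero; suc; _<_; _≤_; _<ᵇ_)
open import Data.Bool using (Bool; true; false; T; _∧_; if_then_else_)
open import Data.Fin using (Fin; toℕ)
open import Data.Fin.Properties using (_≟_)
open import Data.List using (List; []; _∷_; _++_; map; filterᵇ; reverse; length)
open import Data.List.Base using (allFin)
open import Data.Product using (Σ; _×_; ∃; _,_)
open import Data.Empty using (⊥)
open import Data.Unit using (⊤)
open import Relation.Nullary using (¬_; ⌊_⌋)
open import Relation.Binary.PropositionalEquality using (_≡_; _≢_)
open import Function.Definitions using (Injective)
open import Function.Bundles using (_⇔_)
import Data.Rational as ℚ
open ℚ using (ℚ; 1ℚ)

data LexLt : List ℕ → List ℕ → Set where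
  nil  : ∀ {y ys} → LexLt [] (y ∷ ys)
  head : ∀ {x y xs ys} → x < y → LexLt (x ∷ xs) (y ∷ ys)
  tail : ∀ {x xs ys} → LexLt xs ys → LexLt (x ∷ xs) (x ∷ ys)

record Graph (n : ℕ) : Set where
  field
    adj   : Fin n → Fin n → Bool
    sym   : ∀ u v → adj u v ≡ adj v u
    irrefl : ∀ v → adj v v ≡ false

open Graph public

module _ {n : ℕ} (G : Graph n) where

  Adj : Fin n → Fin n → Set
  Adj u v = T (adj G u v)

  data Reach (P : Fin n → Set) : Fin n → Fin n → Set where
    here : ∀ {u} → P u → Reach P u u
    step : ∀ {u w v} → P u → Adj u w → Reach P w v → Reach P u v

  Connected : Set
  Connected = ∀ u v → Reach (λ _ → ⊤) u v

  OutsideClosedNbhd : Fin n → Fin n → Set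
  OutsideClosedNbhd t v = (v ≢ t) × ¬ Adj t v

  -- G - N[t] is connected (the empty graph counts as connected)
  ConnectedMinusClosedNbhd : Fin n → Set
  ConnectedMinusClosedNbhd t =
    ∀ u v → OutsideClosedNbhd t u → OutsideClosedNbhd t v →
      Reach (OutsideClosedNbhd t) u v

  Simplicial : Fin n → Set
  Simplicial t = ∀ u w → Adj t u → Adj t w → u ≢ w → Adj u w

  -- intersection graph of unit-length closed intervals [f v, f v + 1]
  -- (left endpoints taken rational)
  IsUnitIntervalGraph : Set
  IsUnitIntervalGraph =
    Σ (Fin n → ℚ) λ f → ∀ u v → u ≢ v →
      (Adj u v ⇔ ((f u ℚ.≤ f v ℚ.+ 1ℚ) × (f v ℚ.≤ f u ℚ.+ 1ℚ)))

  -- A vertex ordering: σ i is the vertex at position i (0-based),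
  -- σ a bijection Fin n → Fin n (injective suffices on a finite set).
  Ordering : Set
  Ordering = Σ (Fin n → Fin n) λ σ → Injective _≡_ _≡_ σ

  LastVertex : Ordering → Fin n → Set
  LastVertex (σ , _) t = Σ (Fin n) λ i → (suc (toℕ i) ≡ n) × (σ i ≡ t)

  IsUnitIntervalOrder : Ordering → Set
  IsUnitIntervalOrder (σ , _) =
    ∀ i j k → toℕ i < toℕ j → toℕ j < toℕ k →
      Adj (σ i) (σ k) → Adj (σ i) (σ j) × Adj (σ j) (σ k)

  -- MNS: at step (position) i the label of an unnumbered vertex v is the set
  -- of positions p < i with σ p adjacent to v.
  MNSLabel⊆ : (Fin n → Fin n) → Fin n → Fin n → Fin n → Set
  MNSLabel⊆ σ i v w = ∀ p → toℕ p < toℕ i → Adj (σ p) v → Adj (σ p) w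

  MNSLabel⊂ : (Fin n → Fin n) → Fin n → Fin n → Fin n → Set
  MNSLabel⊂ σ i v w = MNSLabel⊆ σ i v w ×
    Σ (Fin n) λ p → (toℕ p < toℕ i) × Adj (σ p) w × ¬ Adj (σ p) v

  IsMNSOrdering : Ordering → Set
  IsMNSOrdering (σ , _) =
    ∀ i j → toℕ i < toℕ j → ¬ MNSLabel⊂ σ i (σ i) (σ j)

  numberedNbrs : (Fin n → Fin n) → Fin n → Fin n → ℕ
  numberedNbrs σ i v =
    length (filterᵇ (λ p → (toℕ p <ᵇ toℕ i) ∧ adj G (σ p) v) (allFin n))

  IsMCSOrdering : Ordering → Set
  IsMCSOrdering (σ , _) =
    ∀ i j → toℕ i < toℕ j → numberedNbrs σ i (σ j) ≤ numberedNbrs σ i (σ i)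

  -- LDFS: the label at step i (0-based position; numbers are 1-based) of an
  -- unnumbered vertex v is the string of numbers (suc p), p < i, σ p adjacent
  -- to v, most recent first, followed by 0 if v is the start vertex s.
  ldfsLabel : (Fin n → Fin n) → Fin n → Fin n → Fin n → List ℕ
  ldfsLabel σ s i v =
    map (λ p → suc (toℕ p))
        (filterᵇ (λ p → (toℕ p <ᵇ toℕ i) ∧ adj G (σ p) v) (reverse (allFin n)))
    ++ (if ⌊ v ≟ s ⌋ then 0 ∷ [] else [])

  IsLDFSOrdering : Ordering → Set
  IsLDFSOrdering (σ , _) =
    Σ (Fin n) λ s → ∀ i j → toℕ i < toℕ j →
      ¬ LexLt (ldfsLabel σ s i (σ i)) (ldfsLabel σ s i (σ j))

-- Fix a unit interval representation f of G and call a non-neighbour v ≠ t of t far left if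
-- f v + 1 < f t and far right if f t + 1 < f v. No edge joins the two sides, and reflecting the
-- line (f ↦ -f) exchanges them.
--
-- (i) ⇒ (ii): as G - N[t] is connected, one side is empty, say the far-right one. Sorting the
-- vertices by f with t moved to the end gives a unit interval order: a triple whose last vertex
-- is t and whose middle vertex lies to the right of t consists of neighbours of t, and these
-- form a clique. Unit interval orders are MNS, MCS and LDFS orderings; conversely a strict
-- inclusion of MNS labels makes the later label strictly larger both in size and
-- lexicographically, so MCS and LDFS orderings are MNS orderings.
--
-- (iii) ⇒ (i): in an MNS ordering of a connected graph every prefix induces a connected graph,
-- and a vertex all of whose numbered neighbours are neighbours of the last vertex t is adjacent
-- to every numbered neighbour of t. Applied to the first far-right vertex this shows that no
-- far-left vertex precedes it, so one side is empty, say the far-left one. Applied to the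
-- earliest vertex of N(t) with a non-neighbour in N(t), it yields a far-right vertex adjacent
-- to the later but not to the earlier of two vertices, contradicting MNS; so t is simplicial.
-- Finally G - N[t] is the far-right side, and a walk in G between two far-right vertices can be
-- rerouted through that side.

module Submission where

open import Data.Bool using (Bool; T; _∧_; if_then_else_)
import Data.Bool.Properties as Bool
open import Data.Empty using (⊥; ⊥-elim)
open import Data.Fin as Fin using (Fin; toℕ; zero; suc; _<_; punchOut)
import Data.Fin.Properties as Fin
open import Data.List using (List; []; _∷_; _++_; map; filter; filterᵇ; reverse; length; allFin)
import Data.List.Properties as List
open import Data.List.Membership.Propositional using (_∈_)
open import Data.List.Membership.Propositional.Properties using (∈-allFin; ∈-filter⁺; ∈-filter⁻)
import Data.List.Membership.Setoid.Properties as Membership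
open import Data.List.Relation.Unary.All as All using (All; []; _∷_)
import Data.List.Relation.Unary.All.Properties as All
import Data.List.Relation.Unary.Any as Any
open import Data.List.Relation.Unary.AllPairs using (AllPairs; []; _∷_)
import Data.List.Relation.Unary.AllPairs.Properties as AllPairs
open import Data.List.Relation.Binary.Sublist.Propositional using (_⊆_; []; _∷_; _∷ʳ_; ⊆-refl)
import Data.List.Relation.Binary.Sublist.Propositional.Properties as Sublist
open import Data.List.Relation.Binary.Equality.Propositional using (≋⇒≡)
open import Data.Nat as ℕ using (ℕ; zero; suc; z≤n; s≤s; _<ᵇ_)
import Data.Nat.Properties as ℕ
open import Data.Product using (Σ; ∃; ∃₂; _×_; _,_; proj₁; proj₂)
open import Data.Sum using (_⊎_; inj₁; inj₂) renaming (map to ⊎-map)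
open import Function using (id; _∘_; flip; _on_)
open import Function.Bundles using (_⇔_; mk⇔; Equivalence)
open import Function.Definitions using (Injective)
open import Relation.Binary using (Rel; tri<; tri≈; tri>)
open import Relation.Binary.PropositionalEquality
  using (_≡_; _≢_; refl; sym; trans; cong; subst; subst₂; setoid; module ≡-Reasoning)
open import Relation.Nullary using (¬_; Dec; yes; no; ¬?; _×-dec_; _⊎-dec_; ⌊_⌋; decidable-stable)
open import Relation.Nullary.Decidable using (T?)
open import Relation.Unary using (Decidable)

open import Data.Rational as ℚ using (ℚ; 0ℚ; 1ℚ; _+_; -_)
import Data.Rational.Properties as ℚ
open import Algebra.Properties.Group ℚ.+-0-group using () renaming (⁻¹-involutive to neg-involutive)

open import Defs hiding (sym)

¬LexLt-[] : ∀ {xs} → ¬ LexLt xs []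
¬LexLt-[] ()

All<⇒LexLt : ∀ {y zs ws} → All (ℕ._< y) zs → LexLt zs (y ∷ ws)
All<⇒LexLt []        = nil
All<⇒LexLt (z<y ∷ _) = head z<y

sublist-¬LexLt : ∀ {xs ys} m → ys ⊆ xs → AllPairs ℕ._>_ xs → ¬ LexLt (xs ++ m) ys
sublist-¬LexLt m []             []        = ¬LexLt-[]
sublist-¬LexLt m (_ ∷ʳ ys⊆xs)   (x>xs ∷ _) (head x<y) =
  ℕ.<-asym x<y (All.head (Sublist.All-resp-⊆ ys⊆xs x>xs))
sublist-¬LexLt m (_ ∷ʳ ys⊆xs)   (x>xs ∷ _) (tail _)   =
  ℕ.<-irrefl refl (All.head (Sublist.All-resp-⊆ ys⊆xs x>xs))
sublist-¬LexLt m (refl ∷ _)     _          (head x<x) = ℕ.<-irrefl refl x<x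
sublist-¬LexLt m (refl ∷ ys⊆xs) (_ ∷ xs>)  (tail lt)  = sublist-¬LexLt m ys⊆xs xs> lt

sublist-LexLt : ∀ {xs ys} m m′ → xs ⊆ ys → xs ≢ ys → AllPairs ℕ._>_ ys →
  All (λ y → All (ℕ._< y) m) ys → LexLt (xs ++ m) (ys ++ m′)
sublist-LexLt m m′ []             xs≢ys _          _          = ⊥-elim (xs≢ys refl)
sublist-LexLt m m′ (_ ∷ʳ xs⊆ys)   _     (y>ys ∷ _) (m<y ∷ _)  =
  All<⇒LexLt (All.++⁺ (Sublist.All-resp-⊆ xs⊆ys y>ys) m<y)
sublist-LexLt m m′ (refl ∷ xs⊆ys) xs≢ys (_ ∷ ys>)  (_ ∷ m<ys) =
  tail (sublist-LexLt m m′ xs⊆ys (xs≢ys ∘ cong (_ ∷_)) ys> m<ys)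

sublist-length-< : ∀ {A : Set} {xs ys : List A} → xs ⊆ ys → xs ≢ ys → length xs ℕ.< length ys
sublist-length-< xs⊆ys xs≢ys with ℕ.m≤n⇒m<n∨m≡n (Sublist.length-mono-≤ xs⊆ys)
... | inj₁ lt = lt
... | inj₂ eq = ⊥-elim (xs≢ys (≋⇒≡ (Sublist.to-≋ eq xs⊆ys)))

module _ {A : Set} {P Q : A → Set} (P? : Decidable P) (Q? : Decidable Q) (P⇒Q : ∀ {x} → P x → Q x) where

  filter-⊆ : (xs : List A) → filter P? xs ⊆ filter Q? xs
  filter-⊆ xs = Sublist.filter⁺ P? Q? (λ { refl → P⇒Q }) (⊆-refl {x = xs})

  filter-≢ : ∀ {x xs} → x ∈ xs → Q x → ¬ P x → filter P? xs ≢ filter Q? xs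
  filter-≢ {xs = xs} x∈xs Qx ¬Px eq =
    ¬Px (proj₂ (∈-filter⁻ P? {xs = xs} (subst (_ ∈_) (sym eq) (∈-filter⁺ Q? x∈xs Qx))))

AllPairs-reverse : ∀ {A : Set} {ℓ} {R : Rel A ℓ} {xs} → AllPairs R xs → AllPairs (flip R) (reverse xs)
AllPairs-reverse [] = []
AllPairs-reverse {R = R} {x ∷ xs} (Rx ∷ Rxs) =
  subst (AllPairs (flip R)) (sym (List.unfold-reverse x xs))
    (AllPairs.++⁺ (AllPairs-reverse Rxs) ([] ∷ [])
      (All.tabulate (λ y∈ → All.lookup Rx (Membership.reverse⁻ (setoid _) y∈) ∷ [])))

Minimal : ∀ {n} → (Fin n → Set) → Fin n → Set
Minimal P m = P m × (∀ j → j < m → ¬ P j)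

minimal : ∀ {n} {P : Fin n → Set} → Decidable P → ∀ {i} → P i → ∃ (Minimal P)
minimal {n} {P} P? {i} Pi with Fin.¬∀⟶∃¬-smallest n (¬_ ∘ P) (¬? ∘ P?) (λ ¬P → ¬P i Pi)
... | m , ¬¬Pm , below =
  m , decidable-stable (P? m) ¬¬Pm , λ j j<m → below (Fin.fromℕ< j<m) ∘ subst P (sym (inject-fromℕ< j<m))
  where
  inject-fromℕ< : ∀ {j} (j<m : j < m) → Fin.inject (Fin.fromℕ< j<m) ≡ j
  inject-fromℕ< j<m = Fin.toℕ-injective (trans (Fin.toℕ-inject _) (Fin.toℕ-fromℕ< j<m))

minimal-≤ : ∀ {n} {P : Fin n → Set} {m i} → Minimal P m → P i → toℕ m ℕ.≤ toℕ i
minimal-≤ (_ , below) Pi = ℕ.≮⇒≥ (λ i<m → below _ i<m Pi)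

injective⇒surjective : ∀ {n} {f : Fin n → Fin n} → Injective _≡_ _≡_ f → ∀ y → ∃ λ x → f x ≡ y
injective⇒surjective {zero}      _   ()
injective⇒surjective {suc m} {f} inj y with Fin.any? (λ x → f x Fin.≟ y)
... | yes hit  = hit
... | no  miss = ⊥-elim (ℕ.<-irrefl refl (Fin.injective⇒≤ punchOut-injective))
  where
  y≢f : ∀ x → y ≢ f x
  y≢f x eq = miss (x , sym eq)
  punchOut-injective : Injective _≡_ _≡_ (λ x → punchOut (y≢f x))
  punchOut-injective eq = inj (Fin.punchOut-injective (y≢f _) (y≢f _) eq)

firstPosition : ∀ {n} → Fin n → Fin n
firstPosition zero    = zero
firstPosition (suc _) = zero

toℕ-firstPosition : ∀ {n} (i : Fin n) → toℕ (firstPosition i) ≡ 0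
toℕ-firstPosition zero    = refl
toℕ-firstPosition (suc _) = refl

lastPosition : ∀ {n} → Fin n → Σ (Fin n) λ i → suc (toℕ i) ≡ n
lastPosition {suc m} _ = Fin.fromℕ m , cong suc (Fin.toℕ-fromℕ m)

below-lastPosition : ∀ {n} {i j : Fin n} → suc (toℕ i) ≡ n → j ≢ i → j < i
below-lastPosition {i = i} {j} last j≢i
  with ℕ.m≤n⇒m<n∨m≡n (ℕ.s≤s⁻¹ (subst (suc (toℕ j) ℕ.≤_) (sym last) (Fin.toℕ<n j)))
... | inj₁ j<i = j<i
... | inj₂ j≡i = ⊥-elim (j≢i (Fin.toℕ-injective j≡i))

module Sorting {n} {_≺_ : Fin n → Fin n → Set} (_≺?_ : ∀ u v → Dec (u ≺ v))
  (≺-irrefl : ∀ {v} → ¬ v ≺ v) (≺-trans : ∀ {u v w} → u ≺ v → v ≺ w → u ≺ w)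
  (≺-connex : ∀ {u v} → u ≢ v → u ≺ v ⊎ v ≺ u) where

  rank : Fin n → ℕ
  rank v = length (filter (_≺? v) (allFin n))

  rank-mono : ∀ {u v} → u ≺ v → rank u ℕ.< rank v
  rank-mono {u} {v} u≺v = sublist-length-< (filter-⊆ (_≺? u) (_≺? v) (λ w≺u → ≺-trans w≺u u≺v) (allFin n))
    (filter-≢ (_≺? u) (_≺? v) (λ w≺u → ≺-trans w≺u u≺v) (∈-allFin u) u≺v ≺-irrefl)

  rank<n : ∀ v → rank v ℕ.< n
  rank<n v = subst (rank v ℕ.<_) (List.length-tabulate id)
    (List.filter-notAll (_≺? v) (allFin n) (Any.map (λ { refl → ≺-irrefl }) (∈-allFin v)))

  rankPosition : Fin n → Fin n
  rankPosition v = Fin.fromℕ< (rank<n v)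

  rankPosition-injective : Injective _≡_ _≡_ rankPosition
  rankPosition-injective {u} {v} eq with u Fin.≟ v
  ... | yes u≡v = u≡v
  ... | no  u≢v with ≺-connex u≢v
  ...   | inj₁ u≺v = ⊥-elim (ℕ.<⇒≢ (rank-mono u≺v) (Fin.fromℕ<-injective _ _ (rank<n u) (rank<n v) eq))
  ...   | inj₂ v≺u = ⊥-elim (ℕ.<⇒≢ (rank-mono v≺u) (Fin.fromℕ<-injective _ _ (rank<n v) (rank<n u) (sym eq)))

  sorted : Fin n → Fin n
  sorted i = proj₁ (injective⇒surjective rankPosition-injective i)

  rankPosition-sorted : ∀ i → rankPosition (sorted i) ≡ i
  rankPosition-sorted i = proj₂ (injective⇒surjective rankPosition-injective i)

  rank-sorted : ∀ i → rank (sorted i) ≡ toℕ i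
  rank-sorted i = trans (sym (Fin.toℕ-fromℕ< (rank<n (sorted i)))) (cong toℕ (rankPosition-sorted i))

  sorted-injective : Injective _≡_ _≡_ sorted
  sorted-injective {i} {j} eq = Fin.toℕ-injective (trans (sym (rank-sorted i)) (trans (cong rank eq) (rank-sorted j)))

  sorted-monotone : ∀ {i j} → i < j → sorted i ≺ sorted j
  sorted-monotone {i} {j} i<j with ≺-connex (ℕ.<⇒≢ i<j ∘ cong toℕ ∘ sorted-injective)
  ... | inj₁ i≺j = i≺j
  ... | inj₂ j≺i = ⊥-elim (ℕ.<-asym i<j (subst₂ ℕ._<_ (rank-sorted j) (rank-sorted i) (rank-mono j≺i)))

  sorted-last : ∀ {m i} → (∀ {v} → v ≢ m → v ≺ m) → suc (toℕ i) ≡ n → sorted i ≡ m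
  sorted-last {m} {i} maximum last with sorted i Fin.≟ m
  ... | yes σi≡m = σi≡m
  ... | no  σi≢m = ⊥-elim (≺-irrefl (≺-trans (maximum σi≢m) (subst (_≺ sorted i) σk≡m (sorted-monotone k<i))))
    where
    k = rankPosition m
    σk≡m : sorted k ≡ m
    σk≡m = rankPosition-injective (rankPosition-sorted k)
    k<i : k < i
    k<i = below-lastPosition last (λ k≡i → σi≢m (trans (cong sorted (sym k≡i)) σk≡m))

module _ {n} (G : Graph n) where

  adj-sym : ∀ {u v} → Adj G u v → Adj G v u
  adj-sym {u} {v} = subst T (Graph.sym G u v)

  adj⇒≢ : ∀ {u v} → Adj G u v → u ≢ v
  adj⇒≢ {u} u~u refl = subst T (Graph.irrefl G u) u~u

  adj? : ∀ u v → Dec (Adj G u v)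
  adj? u v = T? (adj G u v)

  reach-map : ∀ {P Q : Fin n → Set} → (∀ {v} → P v → Q v) → ∀ {a b} → Reach G P a b → Reach G Q a b
  reach-map P⇒Q (here Pa)         = here (P⇒Q Pa)
  reach-map P⇒Q (step Pa a~w rest) = step (P⇒Q Pa) a~w (reach-map P⇒Q rest)

  reach-start : ∀ {P : Fin n → Set} {a b} → Reach G P a b → P a
  reach-start (here Pa)     = Pa
  reach-start (step Pa _ _) = Pa

  walk-crossing : ∀ {P Q : Fin n → Set} → Decidable Q → ∀ {a b} → Reach G P a b → Q a → ¬ Q b →
    ∃₂ λ x y → Q x × ¬ Q y × Adj G x y
  walk-crossing Q? (here _)                 Qa ¬Qb = ⊥-elim (¬Qb Qa)
  walk-crossing Q? (step {u} {w} _ u~w rest) Qa ¬Qb with Q? w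
  ... | yes Qw = walk-crossing Q? rest Qw ¬Qb
  ... | no ¬Qw = u , w , Qa , ¬Qw , u~w

-- Search orderings

module Labels {n} (G : Graph n) (σ : Fin n → Fin n) where

  numberedNbr : Fin n → Fin n → Fin n → Bool
  numberedNbr i v p = (toℕ p <ᵇ toℕ i) ∧ adj G (σ p) v

  numberedNbr⁺ : ∀ {i v p} → p < i → Adj G (σ p) v → T (numberedNbr i v p)
  numberedNbr⁺ p<i p~v = Equivalence.from Bool.T-∧ (ℕ.<⇒<ᵇ p<i , p~v)

  numberedNbr⁻ : ∀ {i v p} → T (numberedNbr i v p) → p < i × Adj G (σ p) v
  numberedNbr⁻ {i} {v} {p} x with Equivalence.to (Bool.T-∧ {toℕ p <ᵇ toℕ i}) x
  ... | p<ᵇi , p~v = ℕ.<ᵇ⇒< _ _ p<ᵇi , p~v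

  numberedNbrs-⊆ : ∀ {i v w} → MNSLabel⊆ G σ i v w → ∀ ps →
    filterᵇ (numberedNbr i v) ps ⊆ filterᵇ (numberedNbr i w) ps
  numberedNbrs-⊆ {i} {v} {w} v⊆w = filter-⊆ (T? ∘ numberedNbr i v) (T? ∘ numberedNbr i w) λ x →
    let p<i , p~v = numberedNbr⁻ {i} {v} x in numberedNbr⁺ p<i (v⊆w _ p<i p~v)

  numberedNbrs-≢ : ∀ {i v w} → MNSLabel⊂ G σ i v w → ∀ {ps} → (∀ p → p ∈ ps) →
    filterᵇ (numberedNbr i v) ps ≢ filterᵇ (numberedNbr i w) ps
  numberedNbrs-≢ {i} {v} {w} (v⊆w , p , p<i , p~w , p≁v) all∈ =
    filter-≢ (T? ∘ numberedNbr i v) (T? ∘ numberedNbr i w)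
      (λ x → let q<i , q~v = numberedNbr⁻ {i} {v} x in numberedNbr⁺ q<i (v⊆w _ q<i q~v))
      (all∈ p) (numberedNbr⁺ p<i p~w) (p≁v ∘ proj₂ ∘ numberedNbr⁻ {i} {v})

  ldfsNumbers : Fin n → Fin n → List ℕ
  ldfsNumbers i v = map (suc ∘ toℕ) (filterᵇ (numberedNbr i v) (reverse (allFin n)))

  ldfsNumbers-descending : ∀ i v → AllPairs ℕ._>_ (ldfsNumbers i v)
  ldfsNumbers-descending i v =
    AllPairs.map⁺ (AllPairs.filter⁺ _ (AllPairs-reverse (AllPairs.tabulate⁺-< {R = ℕ._<_ on (suc ∘ toℕ)} s≤s)))

  ldfsNumbers-⊆ : ∀ {i v w} → MNSLabel⊆ G σ i v w → ldfsNumbers i v ⊆ ldfsNumbers i w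
  ldfsNumbers-⊆ v⊆w = Sublist.map⁺ (suc ∘ toℕ) (numberedNbrs-⊆ v⊆w (reverse (allFin n)))

  ldfsNumbers-≢ : ∀ {i v w} → MNSLabel⊂ G σ i v w → ldfsNumbers i v ≢ ldfsNumbers i w
  ldfsNumbers-≢ v⊂w = numberedNbrs-≢ v⊂w {reverse (allFin n)} (Membership.reverse⁺ (setoid _) ∘ ∈-allFin)
    ∘ List.map-injective (Fin.toℕ-injective ∘ ℕ.suc-injective)

  startMark : Fin n → Fin n → List ℕ
  startMark v s = if ⌊ v Fin.≟ s ⌋ then 0 ∷ [] else []

  startMark-≢ : ∀ {v s} → v ≢ s → startMark v s ≡ []
  startMark-≢ {v} {s} v≢s with v Fin.≟ s
  ... | yes v≡s = ⊥-elim (v≢s v≡s)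
  ... | no  _   = refl

  startMark-below : ∀ v s k → All (ℕ._< suc k) (startMark v s)
  startMark-below v s k with v Fin.≟ s
  ... | yes _ = s≤s z≤n ∷ []
  ... | no  _ = []

module _ {n} (G : Graph n) where

  open Labels G

  uio⇒label⊇ : ∀ σ (σ-injective : Injective _≡_ _≡_ σ) → IsUnitIntervalOrder G (σ , σ-injective) →
    ∀ {i j} → i < j → MNSLabel⊆ G σ i (σ j) (σ i)
  uio⇒label⊇ σ σ-injective uio {i} {j} i<j p p<i p~σj = proj₁ (uio p i j p<i i<j p~σj)

  uio⇒mns : ∀ o → IsUnitIntervalOrder G o → IsMNSOrdering G o
  uio⇒mns (σ , _) uio i j i<j (_ , p , p<i , p~σj , p≁σi) = p≁σi (proj₁ (uio p i j p<i i<j p~σj))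

  uio⇒mcs : ∀ o → IsUnitIntervalOrder G o → IsMCSOrdering G o
  uio⇒mcs (σ , σ-injective) uio i j i<j =
    Sublist.length-mono-≤ (numberedNbrs-⊆ σ (uio⇒label⊇ σ σ-injective uio i<j) (allFin n))

  uio⇒ldfs : Fin n → ∀ o → IsUnitIntervalOrder G o → IsLDFSOrdering G o
  uio⇒ldfs v (σ , σ-injective) uio = σ first , ¬lt
    where
    first = firstPosition v
    ¬lt : ∀ i j → i < j → ¬ LexLt (ldfsLabel G σ (σ first) i (σ i)) (ldfsLabel G σ (σ first) i (σ j))
    ¬lt i j i<j lt = sublist-¬LexLt (startMark σ (σ i) (σ first))
      (ldfsNumbers-⊆ σ (uio⇒label⊇ σ σ-injective uio i<j)) (ldfsNumbers-descending σ i (σ i))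
      (subst (LexLt _) (trans (cong (ldfsNumbers σ i (σ j) ++_) (startMark-≢ σ σj≢first)) (List.++-identityʳ _)) lt)
      where
      σj≢first : σ j ≢ σ first
      σj≢first eq = ℕ.<⇒≢ (ℕ.≤-<-trans z≤n i<j)
        (trans (sym (toℕ-firstPosition v)) (cong toℕ (sym (σ-injective eq))))

  mcs⇒mns : ∀ o → IsMCSOrdering G o → IsMNSOrdering G o
  mcs⇒mns (σ , _) mcs i j i<j σi⊂σj = ℕ.<⇒≱
    (sublist-length-< (numberedNbrs-⊆ σ (proj₁ σi⊂σj) (allFin n)) (numberedNbrs-≢ σ σi⊂σj ∈-allFin))
    (mcs i j i<j)

  ldfs⇒mns : ∀ o → IsLDFSOrdering G o → IsMNSOrdering G o
  ldfs⇒mns (σ , _) (s , ldfs) i j i<j σi⊂σj = ldfs i j i<j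
    (sublist-LexLt (startMark σ (σ i) s) (startMark σ (σ j) s)
      (ldfsNumbers-⊆ σ (proj₁ σi⊂σj)) (ldfsNumbers-≢ σ σi⊂σj) (ldfsNumbers-descending σ i (σ j))
      (All.map⁺ (All.universal (λ p → startMark-below σ (σ i) s (toℕ p)) _)))

  mapLastVertex : ∀ {t} {P Q : Ordering G → Set} → (∀ o → P o → Q o) →
    Σ (Ordering G) (λ o → P o × LastVertex G o t) → Σ (Ordering G) (λ o → Q o × LastVertex G o t)
  mapLastVertex P⇒Q (o , Po , last) = o , P⇒Q o Po , last

-- MNS orderings of connected graphs

module MNSStructure {n} (G : Graph n) (connected : Connected G) (σ : Fin n → Fin n)
  (σ-injective : Injective _≡_ _≡_ σ) (mns : IsMNSOrdering G (σ , σ-injective)) where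

  position : Fin n → Fin n
  position v = proj₁ (injective⇒surjective σ-injective v)

  σ-position : ∀ v → σ (position v) ≡ v
  σ-position v = proj₂ (injective⇒surjective σ-injective v)

  Numbered : Fin n → Fin n → Set
  Numbered i v = ∃ λ p → p < i × σ p ≡ v

  numbered? : ∀ i → Decidable (Numbered i)
  numbered? i v = Fin.any? (λ p → (p Fin.<? i) ×-dec (σ p Fin.≟ v))

  earlierNeighbour : ∀ i → 0 ℕ.< toℕ i → ∃ λ p → p < i × Adj G (σ p) (σ i)
  earlierNeighbour i 0<i with Fin.any? (λ p → (p Fin.<? i) ×-dec adj? G (σ p) (σ i))
  ... | yes found = found
  ... | no  none  = frontier (walk-crossing G (numbered? i) (connected (σ first) (σ i))
                               (first , first<i , refl) (λ (p , p<i , σp≡σi) → σp≢σi p<i σp≡σi))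
    where
    first = firstPosition i
    first<i : first < i
    first<i = subst (ℕ._< toℕ i) (sym (toℕ-firstPosition i)) 0<i
    σp≢σi : ∀ {p} → p < i → σ p ≢ σ i
    σp≢σi p<i σp≡σi = ℕ.<⇒≢ p<i (cong toℕ (σ-injective σp≡σi))
    frontier : (∃₂ λ x y → Numbered i x × ¬ Numbered i y × Adj G x y) → ∃ λ p → p < i × Adj G (σ p) (σ i)
    frontier (_ , y , (p , p<i , refl) , y-unnumbered , σp~y) with Fin.<-cmp i (position y)
    ... | tri< i<j _ _ = ⊥-elim (mns i (position y) i<j
          ( (λ q q<i q~σi → ⊥-elim (none (q , q<i , q~σi)))
          , p , p<i , subst (Adj G (σ p)) (sym (σ-position y)) σp~y , λ p~σi → none (p , p<i , p~σi)))
    ... | tri≈ _ i≡j _ = p , p<i , subst (Adj G (σ p)) (trans (sym (σ-position y)) (cong σ (sym i≡j))) σp~y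
    ... | tri> _ _ j<i = ⊥-elim (y-unnumbered (position y , j<i , σ-position y))

  prefixCrossing : ∀ {A : Fin n → Set} → Decidable A → ∀ {i a b} → a < i → b < i → A (σ a) → ¬ A (σ b) →
    ∃₂ λ p q → p < i × q < i × A (σ p) × ¬ A (σ q) × Adj G (σ p) (σ q)
  prefixCrossing {A} A? {i} a<i b<i Aa ¬Ab with minimal (A? ∘ σ) Aa | minimal (¬? ∘ A? ∘ σ) ¬Ab
  ... | mA , minA@(AmA , belowA) | mB , minB@(¬AmB , belowB) with Fin.<-cmp mA mB
  ... | tri< mA<mB _ _ =
    let p , p<mB , σp~σmB = earlierNeighbour mB (ℕ.≤-<-trans z≤n mA<mB)
    in p , mB , Fin.<-trans p<mB mB<i , mB<i , decidable-stable (A? (σ p)) (belowB p p<mB) , ¬AmB , σp~σmB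
    where
    mB<i = ℕ.≤-<-trans (minimal-≤ minB ¬Ab) b<i
  ... | tri≈ _ refl _ = ⊥-elim (¬AmB AmA)
  ... | tri> _ _ mB<mA =
    let p , p<mA , σp~σmA = earlierNeighbour mA (ℕ.≤-<-trans z≤n mB<mA)
    in mA , p , mA<i , Fin.<-trans p<mA mA<i , AmA , belowA p p<mA , adj-sym G σp~σmA
    where
    mA<i = ℕ.≤-<-trans (minimal-≤ minA Aa) a<i

  label⊆⇒⊇ : ∀ {i j} → i < j → MNSLabel⊆ G σ i (σ i) (σ j) → MNSLabel⊆ G σ i (σ j) (σ i)
  label⊆⇒⊇ i<j i⊆j p p<i p~σj with adj? G (σ p) (σ _)
  ... | yes p~σi = p~σi
  ... | no  p≁σi = ⊥-elim (mns _ _ i<j (i⊆j , p , p<i , p~σj , p≁σi))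

  privateNeighbour : ∀ {i j p} → i < j → p < i → Adj G (σ p) (σ j) → ¬ Adj G (σ p) (σ i) →
    ∃ λ q → q < i × Adj G (σ q) (σ i) × ¬ Adj G (σ q) (σ j)
  privateNeighbour {i} {j} i<j p<i p~σj p≁σi
    with Fin.any? (λ q → (q Fin.<? i) ×-dec (adj? G (σ q) (σ i) ×-dec ¬? (adj? G (σ q) (σ j))))
  ... | yes (q , q<i , q~σi , q≁σj) = q , q<i , q~σi , q≁σj
  ... | no  none = ⊥-elim (p≁σi (label⊆⇒⊇ i<j i⊆j _ p<i p~σj))
    where
    i⊆j : MNSLabel⊆ G σ i (σ i) (σ j)
    i⊆j q q<i q~σi with adj? G (σ q) (σ j)
    ... | yes q~σj = q~σj
    ... | no  q≁σj = ⊥-elim (none (q , q<i , q~σi , q≁σj))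

-- Unit interval representations

<+1 : ∀ a → a ℚ.< a + 1ℚ
<+1 a = subst (ℚ._< a + 1ℚ) (ℚ.+-identityʳ a) (ℚ.+-monoʳ-< a (ℚ.positive⁻¹ 1ℚ))

≤+1 : ∀ a → a ℚ.≤ a + 1ℚ
≤+1 a = ℚ.<⇒≤ (<+1 a)

+1-mono-≤ : ∀ {a b} → a ℚ.≤ b → a + 1ℚ ℚ.≤ b + 1ℚ
+1-mono-≤ = ℚ.+-monoˡ-≤ 1ℚ

+1-mono-< : ∀ {a b} → a ℚ.< b → a + 1ℚ ℚ.< b + 1ℚ
+1-mono-< = ℚ.+-monoˡ-< 1ℚ

neg-+1 : ∀ a → - (a + 1ℚ) + 1ℚ ≡ - a
neg-+1 a = begin
  - (a + 1ℚ) + 1ℚ    ≡⟨ cong (_+ 1ℚ) (ℚ.neg-distrib-+ a 1ℚ) ⟩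
  (- a + - 1ℚ) + 1ℚ  ≡⟨ ℚ.+-assoc (- a) (- 1ℚ) 1ℚ ⟩
  - a + (- 1ℚ + 1ℚ)  ≡⟨ cong (- a +_) (ℚ.+-inverseˡ 1ℚ) ⟩
  - a + 0ℚ           ≡⟨ ℚ.+-identityʳ (- a) ⟩
  - a                ∎
  where open ≡-Reasoning

≤+1⇒neg : ∀ {a b} → a ℚ.≤ b + 1ℚ → - b ℚ.≤ - a + 1ℚ
≤+1⇒neg {a} {b} a≤b+1 = subst (ℚ._≤ - a + 1ℚ) (neg-+1 b) (+1-mono-≤ (ℚ.neg-antimono-≤ a≤b+1))

neg⇒≤+1 : ∀ {a b} → - b ℚ.≤ - a + 1ℚ → a ℚ.≤ b + 1ℚ
neg⇒≤+1 {a} {b} h = subst₂ (λ x y → x ℚ.≤ y + 1ℚ) (neg-involutive a) (neg-involutive b) (≤+1⇒neg h)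

+1<⇒neg : ∀ {a b} → a + 1ℚ ℚ.< b → - b + 1ℚ ℚ.< - a
+1<⇒neg {a} {b} a+1<b = subst (- b + 1ℚ ℚ.<_) (neg-+1 a) (+1-mono-< (ℚ.neg-antimono-< a+1<b))

neg⇒+1< : ∀ {a b} → - b + 1ℚ ℚ.< - a → a + 1ℚ ℚ.< b
neg⇒+1< {a} {b} h = subst₂ (λ x y → x + 1ℚ ℚ.< y) (neg-involutive a) (neg-involutive b) (+1<⇒neg h)

record Representation {n} (G : Graph n) (f : Fin n → ℚ) : Set where
  field
    adj⇔close : ∀ u v → u ≢ v → (Adj G u v ⇔ ((f u ℚ.≤ f v + 1ℚ) × (f v ℚ.≤ f u + 1ℚ)))

FarLeft FarRight : ∀ {n} → (Fin n → ℚ) → Fin n → Fin n → Set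
FarLeft  f t v = f v + 1ℚ ℚ.< f t
FarRight f t v = f t + 1ℚ ℚ.< f v

module Mirror {n} (f : Fin n → ℚ) (t : Fin n) where

  farLeft⇒farRight⁻ : ∀ {v} → FarLeft f t v → FarRight (-_ ∘ f) t v
  farLeft⇒farRight⁻ = +1<⇒neg

  farRight⇒farLeft⁻ : ∀ {v} → FarRight f t v → FarLeft (-_ ∘ f) t v
  farRight⇒farLeft⁻ = +1<⇒neg

  farLeft⁻⇒farRight : ∀ {v} → FarLeft (-_ ∘ f) t v → FarRight f t v
  farLeft⁻⇒farRight = neg⇒+1<

  farRight⁻⇒farLeft : ∀ {v} → FarRight (-_ ∘ f) t v → FarLeft f t v
  farRight⁻⇒farLeft = neg⇒+1<

neg-representation : ∀ {n} {G : Graph n} {f} → Representation G f → Representation G (-_ ∘ f)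
neg-representation rep .Representation.adj⇔close u v u≢v = mk⇔
  (λ u~v → let h₁ , h₂ = Equivalence.to (adj⇔close u v u≢v) u~v in ≤+1⇒neg h₂ , ≤+1⇒neg h₁)
  (λ (h₁ , h₂) → Equivalence.from (adj⇔close u v u≢v) (neg⇒≤+1 h₂ , neg⇒≤+1 h₁))
  where open Representation rep

module UnitIntervals {n} {G : Graph n} {f : Fin n → ℚ} (rep : Representation G f) (t : Fin n) where

  open Representation rep

  adj⇒close : ∀ {u v} → Adj G u v → (f u ℚ.≤ f v + 1ℚ) × (f v ℚ.≤ f u + 1ℚ)
  adj⇒close u~v = Equivalence.to (adj⇔close _ _ (adj⇒≢ G u~v)) u~v

  close⇒adj : ∀ {u v} → u ≢ v → f u ℚ.≤ f v + 1ℚ → f v ℚ.≤ f u + 1ℚ → Adj G u v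
  close⇒adj u≢v h₁ h₂ = Equivalence.from (adj⇔close _ _ u≢v) (h₁ , h₂)

  farLeft? : Decidable (FarLeft f t)
  farLeft? v = f v + 1ℚ ℚ.<? f t

  farRight? : Decidable (FarRight f t)
  farRight? v = f t + 1ℚ ℚ.<? f v

  classify : ∀ {v} → v ≢ t → Adj G t v ⊎ FarLeft f t v ⊎ FarRight f t v
  classify {v} v≢t with adj? G t v | f t ℚ.≤? f v + 1ℚ | f v ℚ.≤? f t + 1ℚ
  ... | yes t~v | _      | _      = inj₁ t~v
  ... | no  _   | no  h₁ | _      = inj₂ (inj₁ (ℚ.≰⇒> h₁))
  ... | no  _   | yes _  | no  h₂ = inj₂ (inj₂ (ℚ.≰⇒> h₂))
  ... | no  t≁v | yes h₁ | yes h₂ = ⊥-elim (t≁v (close⇒adj (v≢t ∘ sym) h₁ h₂))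

  nonFar⇒adj : ∀ {v} → v ≢ t → ¬ FarLeft f t v → ¬ FarRight f t v → Adj G v t
  nonFar⇒adj v≢t ¬farL ¬farR with classify v≢t
  ... | inj₁ t~v         = adj-sym G t~v
  ... | inj₂ (inj₁ farL) = ⊥-elim (¬farL farL)
  ... | inj₂ (inj₂ farR) = ⊥-elim (¬farR farR)

  noFarLeft⇒farRight : (∀ v → ¬ FarLeft f t v) → ∀ {v} → v ≢ t → ¬ Adj G t v → FarRight f t v
  noFarLeft⇒farRight noFarLeft v≢t t≁v with classify v≢t
  ... | inj₁ t~v         = ⊥-elim (t≁v t~v)
  ... | inj₂ (inj₁ farL) = ⊥-elim (noFarLeft _ farL)
  ... | inj₂ (inj₂ farR) = farR

  farLeft⇒≁t : ∀ {v} → FarLeft f t v → ¬ Adj G t v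
  farLeft⇒≁t far t~v = ℚ.<-irrefl refl (ℚ.≤-<-trans (proj₁ (adj⇒close t~v)) far)

  farRight⇒≁t : ∀ {v} → FarRight f t v → ¬ Adj G t v
  farRight⇒≁t far t~v = ℚ.<-irrefl refl (ℚ.≤-<-trans (proj₂ (adj⇒close t~v)) far)

  farLeft⇒≢t : ∀ {v} → FarLeft f t v → v ≢ t
  farLeft⇒≢t far refl = ℚ.<-asym far (<+1 (f t))

  farRight⇒≢t : ∀ {v} → FarRight f t v → v ≢ t
  farRight⇒≢t far refl = ℚ.<-asym far (<+1 (f t))

  leftOf-t-≁-farRight : ∀ {v y} → f v ℚ.≤ f t → FarRight f t y → ¬ Adj G v y
  leftOf-t-≁-farRight v≤t far v~y =
    ℚ.<-irrefl refl (ℚ.≤-<-trans (ℚ.≤-trans (proj₂ (adj⇒close v~y)) (+1-mono-≤ v≤t)) far)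

  farLeft-≁-farRight : ∀ {x y} → FarLeft f t x → FarRight f t y → ¬ Adj G x y
  farLeft-≁-farRight farL = leftOf-t-≁-farRight (ℚ.<⇒≤ (ℚ.<-trans (<+1 _) farL))

  noCommonNeighbour : ∀ {v x y} → FarLeft f t x → FarRight f t y → Adj G v x → ¬ Adj G v y
  noCommonNeighbour farL farR v~x =
    leftOf-t-≁-farRight (ℚ.<⇒≤ (ℚ.≤-<-trans (proj₁ (adj⇒close v~x)) farL)) farR

  farLeft∩farRight : ∀ {v} → FarLeft f t v → FarRight f t v → ⊥
  farLeft∩farRight farL farR = ℚ.<-asym farL (ℚ.<-trans (<+1 (f t)) (ℚ.<-trans farR (<+1 _)))

  farLeft-walk : ∀ {a b} → Reach G (OutsideClosedNbhd G t) a b → FarLeft f t a → FarLeft f t b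
  farLeft-walk (here _)           farA = farA
  farLeft-walk (step _ a~w rest) farA with classify (proj₁ (reach-start G rest))
  ... | inj₁ t~w         = ⊥-elim (proj₂ (reach-start G rest) t~w)
  ... | inj₂ (inj₁ farW) = farLeft-walk rest farW
  ... | inj₂ (inj₂ farW) = ⊥-elim (farLeft-≁-farRight farA farW a~w)

  outside-separated : ConnectedMinusClosedNbhd G t → ∀ {l r} → FarLeft f t l → FarRight f t r → ⊥
  outside-separated connectedOutside farL farR = farLeft∩farRight (farLeft-walk walk farL) farR
    where
    walk = connectedOutside _ _ (farLeft⇒≢t farL , farLeft⇒≁t farL) (farRight⇒≢t farR , farRight⇒≁t farR)

  nonFarRight-nbr-≤ : ∀ {x y} → ¬ FarRight f t x → Adj G x y → f y ℚ.≤ (f t + 1ℚ) + 1ℚ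
  nonFarRight-nbr-≤ ¬farX x~y = ℚ.≤-trans (proj₂ (adj⇒close x~y)) (+1-mono-≤ (ℚ.≮⇒≥ ¬farX))

  farRight-band-adj : ∀ {a w} → a ≢ w → FarRight f t a → FarRight f t w →
    f a ℚ.≤ (f t + 1ℚ) + 1ℚ → f w ℚ.≤ (f t + 1ℚ) + 1ℚ → Adj G a w
  farRight-band-adj a≢w farA farW a≤ w≤ =
    close⇒adj a≢w (ℚ.<⇒≤ (ℚ.≤-<-trans a≤ (+1-mono-< farW))) (ℚ.<⇒≤ (ℚ.≤-<-trans w≤ (+1-mono-< farA)))

  -- a is the far-right vertex where the walk left the far-right side; a and the vertex where
  -- the walk re-enters that side are both adjacent to non-far-right vertices, so both lie in
  -- (f t + 1, f t + 2] and are adjacent.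
  farRight-detour : ∀ {P x b} → Reach G P x b → FarRight f t b → ∀ {a} → FarRight f t a →
    a ≡ x ⊎ (¬ FarRight f t x × f a ℚ.≤ (f t + 1ℚ) + 1ℚ) → Reach G (FarRight f t) a b
  farRight-detour (here _) farB farA (inj₁ refl)        = here farA
  farRight-detour (here _) farB farA (inj₂ (¬farB , _)) = ⊥-elim (¬farB farB)
  farRight-detour (step {w = w} _ x~w rest) farB {a} farA anchor with farRight? w
  ... | yes farW = reenter anchor
    where
    continue = farRight-detour rest farB farW (inj₁ refl)
    reenter : a ≡ _ ⊎ (¬ FarRight f t _ × f a ℚ.≤ (f t + 1ℚ) + 1ℚ) → Reach G (FarRight f t) a _
    reenter (inj₁ refl) = step farA x~w continue
    reenter (inj₂ (¬farX , a≤)) with a Fin.≟ w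
    ... | yes refl = continue
    ... | no  a≢w  = step farA (farRight-band-adj a≢w farA farW a≤ (nonFarRight-nbr-≤ ¬farX x~w)) continue
  ... | no ¬farW = farRight-detour rest farB farA (inj₂ (¬farW , bound anchor))
    where
    bound : a ≡ _ ⊎ (¬ FarRight f t _ × f a ℚ.≤ (f t + 1ℚ) + 1ℚ) → f a ℚ.≤ (f t + 1ℚ) + 1ℚ
    bound (inj₁ refl)    = nonFarRight-nbr-≤ ¬farW (adj-sym G x~w)
    bound (inj₂ (_ , a≤)) = a≤

  connectedOutside : (∀ v → ¬ FarLeft f t v) → Connected G → ConnectedMinusClosedNbhd G t
  connectedOutside noFarLeft connected u v outU outV =
    reach-map G (λ far → farRight⇒≢t far , farRight⇒≁t far)
      (farRight-detour (connected u v) (outside⇒farRight outV) (outside⇒farRight outU) (inj₁ refl))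
    where
    outside⇒farRight : ∀ {v} → OutsideClosedNbhd G t v → FarRight f t v
    outside⇒farRight (v≢t , t≁v) = noFarLeft⇒farRight noFarLeft v≢t t≁v

  between-adj : ∀ {a b c} → a ≢ b → b ≢ c → f a ℚ.≤ f b → f b ℚ.≤ f c → Adj G a c → Adj G a b × Adj G b c
  between-adj a≢b b≢c a≤b b≤c a~c =
    close⇒adj a≢b (ℚ.≤-trans a≤b (≤+1 _)) (ℚ.≤-trans b≤c c≤a+1) ,
    close⇒adj b≢c (ℚ.≤-trans b≤c (≤+1 _)) (ℚ.≤-trans c≤a+1 (+1-mono-≤ a≤b))
    where
    c≤a+1 = proj₂ (adj⇒close a~c)

  rightOf-t-adj : ∀ {u w} → u ≢ w → f t ℚ.≤ f u → f t ℚ.≤ f w → Adj G t u → Adj G t w → Adj G u w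
  rightOf-t-adj u≢w t≤u t≤w t~u t~w = close⇒adj u≢w
    (ℚ.≤-trans (proj₂ (adj⇒close t~u)) (+1-mono-≤ t≤w)) (ℚ.≤-trans (proj₂ (adj⇒close t~w)) (+1-mono-≤ t≤u))

  _<ₗ_ : Fin n → Fin n → Set
  v <ₗ w = f v ℚ.< f w ⊎ (f v ≡ f w × v < w)

  <ₗ-irrefl : ∀ {v} → ¬ v <ₗ v
  <ₗ-irrefl (inj₁ lt)      = ℚ.<-irrefl refl lt
  <ₗ-irrefl (inj₂ (_ , lt)) = ℕ.<-irrefl refl lt

  <ₗ-trans : ∀ {u v w} → u <ₗ v → v <ₗ w → u <ₗ w
  <ₗ-trans (inj₁ u<v)          (inj₁ v<w)          = inj₁ (ℚ.<-trans u<v v<w)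
  <ₗ-trans (inj₁ u<v)          (inj₂ (v≡w , _))    = inj₁ (subst (f _ ℚ.<_) v≡w u<v)
  <ₗ-trans (inj₂ (u≡v , _))    (inj₁ v<w)          = inj₁ (subst (ℚ._< f _) (sym u≡v) v<w)
  <ₗ-trans (inj₂ (u≡v , u<v))  (inj₂ (v≡w , v<w))  = inj₂ (trans u≡v v≡w , ℕ.<-trans u<v v<w)

  <ₗ-connex : ∀ {v w} → v ≢ w → v <ₗ w ⊎ w <ₗ v
  <ₗ-connex {v} {w} v≢w with ℚ.<-cmp (f v) (f w) | Fin.<-cmp v w
  ... | tri< v<w _ _ | _              = inj₁ (inj₁ v<w)
  ... | tri> _ _ w<v | _              = inj₂ (inj₁ w<v)
  ... | tri≈ _ v≈w _ | tri< v<w _ _   = inj₁ (inj₂ (v≈w , v<w))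
  ... | tri≈ _ _ _   | tri≈ _ v≡w _   = ⊥-elim (v≢w v≡w)
  ... | tri≈ _ v≈w _ | tri> _ _ w<v   = inj₂ (inj₂ (sym v≈w , w<v))

  _<ₗ?_ : ∀ v w → Dec (v <ₗ w)
  v <ₗ? w = (f v ℚ.<? f w) ⊎-dec ((f v ℚ.≟ f w) ×-dec (v Fin.<? w))

  _◁_ : Fin n → Fin n → Set
  v ◁ w = v ≢ t × (w ≡ t ⊎ v <ₗ w)

  _◁?_ : ∀ v w → Dec (v ◁ w)
  v ◁? w = ¬? (v Fin.≟ t) ×-dec ((w Fin.≟ t) ⊎-dec (v <ₗ? w))

  ◁-irrefl : ∀ {v} → ¬ v ◁ v
  ◁-irrefl (v≢t , inj₁ v≡t) = v≢t v≡t
  ◁-irrefl (_   , inj₂ v<v) = <ₗ-irrefl v<v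

  ◁-trans : ∀ {u v w} → u ◁ v → v ◁ w → u ◁ w
  ◁-trans (u≢t , _)          (_   , inj₁ w≡t) = u≢t , inj₁ w≡t
  ◁-trans (_   , inj₁ v≡t)   (v≢t , inj₂ _)   = ⊥-elim (v≢t v≡t)
  ◁-trans (u≢t , inj₂ u<v)   (_   , inj₂ v<w) = u≢t , inj₂ (<ₗ-trans u<v v<w)

  ◁-connex : ∀ {v w} → v ≢ w → v ◁ w ⊎ w ◁ v
  ◁-connex {v} {w} v≢w with v Fin.≟ t | w Fin.≟ t
  ... | yes refl | yes refl = ⊥-elim (v≢w refl)
  ... | yes v≡t  | no  w≢t  = inj₂ (w≢t , inj₁ v≡t)
  ... | no  v≢t  | yes w≡t  = inj₁ (v≢t , inj₁ w≡t)
  ... | no  v≢t  | no  w≢t  = ⊎-map (λ v<w → v≢t , inj₂ v<w) (λ w<v → w≢t , inj₂ w<v) (<ₗ-connex v≢w)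

  ◁⇒≢ : ∀ {v w} → v ◁ w → v ≢ w
  ◁⇒≢ v◁v refl = ◁-irrefl v◁v

  ◁⇒≤ : ∀ {v w} → v ◁ w → w ≢ t → f v ℚ.≤ f w
  ◁⇒≤ (_ , inj₁ w≡t)             w≢t = ⊥-elim (w≢t w≡t)
  ◁⇒≤ (_ , inj₂ (inj₁ v<w))      _   = ℚ.<⇒≤ v<w
  ◁⇒≤ (_ , inj₂ (inj₂ (v≡w , _))) _  = ℚ.≤-reflexive v≡w

  open Sorting _◁?_ ◁-irrefl ◁-trans ◁-connex

  module _ (simplicial : Simplicial G t) (noFarRight : ∀ v → ¬ FarRight f t v) where

    ◁-chain-adj : ∀ {a b c} → a ◁ b → b ◁ c → Adj G a c → Adj G a b × Adj G b c
    ◁-chain-adj {a} {b} {c} a◁b b◁c@(b≢t , _) a~c with f b ℚ.≤? f c | c Fin.≟ t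
    ... | yes b≤c | _       = between-adj (◁⇒≢ a◁b) (◁⇒≢ b◁c) (◁⇒≤ a◁b b≢t) b≤c a~c
    ... | no  b≰c | no  c≢t = ⊥-elim (b≰c (◁⇒≤ b◁c c≢t))
    ... | no  t<b | yes refl = simplicial a b (adj-sym G a~c) t~b (◁⇒≢ a◁b) , adj-sym G t~b
      where
      t~b : Adj G t b
      t~b = close⇒adj (b≢t ∘ sym) (ℚ.<⇒≤ (ℚ.<-≤-trans (ℚ.≰⇒> t<b) (≤+1 _))) (ℚ.≮⇒≥ (noFarRight b))

    tLastOrdering : Σ (Ordering G) λ o → IsUnitIntervalOrder G o × LastVertex G o t
    tLastOrdering =
      (sorted , sorted-injective) ,
      (λ i j k i<j j<k → ◁-chain-adj (sorted-monotone i<j) (sorted-monotone j<k)) ,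
      last , last≡n , sorted-last (λ v≢t → v≢t , inj₁ refl) last≡n
      where
      last = proj₁ (lastPosition t)
      last≡n = proj₂ (lastPosition t)

-- The last vertex of an MNS ordering

module LastOfMNS {n} {G : Graph n} {f : Fin n → ℚ} (rep : Representation G f) (connected : Connected G)
  (σ : Fin n → Fin n) (σ-injective : Injective _≡_ _≡_ σ) (mns : IsMNSOrdering G (σ , σ-injective))
  {last t : Fin n} (last≡n : suc (toℕ last) ≡ n) (σlast≡t : σ last ≡ t) where

  open UnitIntervals rep t
  open MNSStructure G connected σ σ-injective mns

  σ≢t⇒<last : ∀ {j} → σ j ≢ t → j < last
  σ≢t⇒<last σj≢t = below-lastPosition last≡n (λ j≡last → σj≢t (trans (cong σ j≡last) σlast≡t))

  <last⇒σ≢t : ∀ {j} → j < last → σ j ≢ t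
  <last⇒σ≢t j<last σj≡t = ℕ.<⇒≢ j<last (cong toℕ (σ-injective (trans σj≡t (sym σlast≡t))))

  label⊆t⇒⊇ : ∀ {i} → i < last → (∀ {p} → p < i → Adj G (σ p) (σ i) → Adj G (σ p) t) →
    ∀ {p} → p < i → Adj G (σ p) t → Adj G (σ p) (σ i)
  label⊆t⇒⊇ i<last i⊆t p<i p~t =
    label⊆⇒⊇ i<last (λ _ q<i q~i → toLast (i⊆t q<i q~i)) _ p<i (toLast p~t)
    where
    toLast : ∀ {v} → Adj G v t → Adj G v (σ last)
    toLast = subst (Adj G _) (sym σlast≡t)

  module _ {r} (farR : FarRight f t (σ r)) (noFarRightBefore : ∀ j → j < r → ¬ FarRight f t (σ j)) where

    r<last : r < last
    r<last = σ≢t⇒<last (farRight⇒≢t farR)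

    nonFarLeft-before-r⇒adj-t : ∀ {p} → p < r → ¬ FarLeft f t (σ p) → Adj G (σ p) t
    nonFarLeft-before-r⇒adj-t p<r ¬farL =
      nonFar⇒adj (<last⇒σ≢t (ℕ.<-trans p<r r<last)) ¬farL (noFarRightBefore _ p<r)

    firstFarRight-label⊆t : ∀ {p} → p < r → Adj G (σ p) (σ r) → Adj G (σ p) t
    firstFarRight-label⊆t p<r p~r = nonFarLeft-before-r⇒adj-t p<r (λ farP → farLeft-≁-farRight farP farR p~r)

    farLeft-before-farRight : ∀ {l} → FarLeft f t (σ l) → l < r → ⊥
    farLeft-before-farRight farL l<r with earlierNeighbour r (ℕ.≤-<-trans z≤n l<r)
    ... | b , b<r , b~r
        with prefixCrossing farLeft? l<r b<r farL
               (λ farB → farLeft⇒≁t farB (adj-sym G (firstFarRight-label⊆t b<r b~r)))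
    ... | y , z , _ , z<r , farY , ¬farZ , y~z =
      noCommonNeighbour farY farR (adj-sym G y~z)
        (label⊆t⇒⊇ r<last firstFarRight-label⊆t z<r (nonFarLeft-before-r⇒adj-t z<r ¬farZ))

  module _ (noFarLeft : ∀ v → ¬ FarLeft f t v) where

    leftOf-t⇒label⊆t : ∀ {i p} → i < last → f (σ i) ℚ.< f t → p < i → Adj G (σ p) (σ i) → Adj G (σ p) t
    leftOf-t⇒label⊆t i<last i<t p<i p~i = nonFar⇒adj (<last⇒σ≢t (ℕ.<-trans p<i i<last)) (noFarLeft _)
      (λ farP → leftOf-t-≁-farRight (ℚ.<⇒≤ i<t) farP (adj-sym G p~i))

    leftOf-t⇒label⊇t : ∀ {i p} → i < last → f (σ i) ℚ.< f t → p < i → Adj G (σ p) t → Adj G (σ p) (σ i)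
    leftOf-t⇒label⊇t i<last i<t = label⊆t⇒⊇ i<last (leftOf-t⇒label⊆t i<last i<t)

    -- The first non-neighbour σ k of σ i after i has, by MNS against t, a numbered neighbour
    -- outside N(t); that vertex is far right, so it is no neighbour of σ i and precedes i.
    farRight-before : ∀ {i j} → i < j → j < last → f (σ i) ℚ.< f t → Adj G (σ i) t → ¬ Adj G (σ i) (σ j) →
      ∃ λ q → q < i × FarRight f t (σ q)
    farRight-before {i} {j} i<j j<last i<t i~t i≁j
      with minimal (λ k → (i Fin.<? k) ×-dec ¬? (adj? G (σ i) (σ k))) (i<j , i≁j)
    ... | k , firstNonNbr@((i<k , i≁k) , noNonNbrBefore) =
      before-i (privateNeighbour k<last i<k (subst (Adj G (σ i)) (sym σlast≡t) i~t) i≁k)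
      where
      k<last : k < last
      k<last = ℕ.≤-<-trans (minimal-≤ firstNonNbr (i<j , i≁j)) j<last
      before-i : (∃ λ q → q < k × Adj G (σ q) (σ k) × ¬ Adj G (σ q) (σ last)) →
        ∃ λ q → q < i × FarRight f t (σ q)
      before-i (q , q<k , _ , q≁last)
        with Fin.<-cmp q i | noFarLeft⇒farRight noFarLeft (<last⇒σ≢t (ℕ.<-trans q<k k<last)) (q≁t ∘ adj-sym G)
        where q≁t = q≁last ∘ subst (Adj G (σ q)) (sym σlast≡t)
      ... | tri< q<i _ _  | farQ = q , q<i , farQ
      ... | tri≈ _ refl _ | _    = ⊥-elim (q≁last (subst (Adj G (σ i)) (sym σlast≡t) i~t))
      ... | tri> _ _ i<q  | farQ = ⊥-elim (noNonNbrBefore q q<k (i<q , leftOf-t-≁-farRight (ℚ.<⇒≤ i<t) farQ))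

    farRight-edge-before : ∀ {i} → i < last → f (σ i) ℚ.< f t → (∃ λ q → q < i × FarRight f t (σ q)) →
      ∃₂ λ y z → y < i × z < i × FarRight f t (σ y) × Adj G (σ z) t × Adj G (σ y) (σ z)
    farRight-edge-before {i} i<last i<t (q , q<i , farQ) with earlierNeighbour i (ℕ.≤-<-trans z≤n q<i)
    ... | p , p<i , p~i with prefixCrossing farRight? q<i p<i farQ (λ farP → farRight⇒≁t farP (adj-sym G p~t))
      where p~t = leftOf-t⇒label⊆t i<last i<t p<i p~i
    ... | y , z , y<i , z<i , farY , ¬farZ , y~z =
      y , z , y<i , z<i , farY , nonFar⇒adj (<last⇒σ≢t (ℕ.<-trans z<i i<last)) (noFarLeft _) ¬farZ , y~z

    Bad : Fin n → Set
    Bad u = Adj G t u × ∃ λ w → Adj G t w × u ≢ w × ¬ Adj G u w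

    bad? : Decidable Bad
    bad? u = adj? G t u ×-dec Fin.any? (λ w → adj? G t w ×-dec (¬? (u Fin.≟ w) ×-dec ¬? (adj? G u w)))

    ¬bad⇒adj : ∀ {u w} → ¬ Bad u → Adj G t u → Adj G t w → u ≢ w → Adj G u w
    ¬bad⇒adj {u} {w} ¬bad t~u t~w u≢w =
      decidable-stable (adj? G u w) (λ u≁w → ¬bad (t~u , w , t~w , u≢w , u≁w))

    -- A far-right y adjacent to some z ∈ N(t), both numbered before i, sees σ j but not σ i,
    -- while every numbered neighbour of σ i sees σ j: MNS fails at step i.
    ¬leftRight-nonEdge : ∀ {i j} → i < j → j < last → (∀ p → p < i → ¬ Bad (σ p)) →
      Adj G t (σ i) → Adj G t (σ j) → f (σ i) ℚ.< f t → f t ℚ.≤ f (σ j) → ¬ Adj G (σ i) (σ j) → ⊥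
    ¬leftRight-nonEdge {i} {j} i<j j<last noBadBefore t~i t~j i<t t≤j i≁j =
      violation (farRight-edge-before i<last i<t (farRight-before i<j j<last i<t (adj-sym G t~i) i≁j))
      where
      i<last = ℕ.<-trans i<j j<last
      σ-<⇒≢ : ∀ {p q} → p < q → σ p ≢ σ q
      σ-<⇒≢ p<q = ℕ.<⇒≢ p<q ∘ cong toℕ ∘ σ-injective
      i⊆j : MNSLabel⊆ G σ i (σ i) (σ j)
      i⊆j p p<i p~i = ¬bad⇒adj (noBadBefore p p<i) (adj-sym G (leftOf-t⇒label⊆t i<last i<t p<i p~i)) t~j
        (σ-<⇒≢ (ℕ.<-trans p<i i<j))
      gap : f (σ i) + 1ℚ ℚ.< f (σ j)
      gap = ℚ.≰⇒> λ j≤i+1 →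
        i≁j (close⇒adj (σ-<⇒≢ i<j) (ℚ.<⇒≤ (ℚ.<-≤-trans i<t (ℚ.≤-trans t≤j (≤+1 (f (σ j)))))) j≤i+1)
      farRight-adj-j : ∀ {y z} → FarRight f t (σ y) → z < i → Adj G (σ z) t → Adj G (σ y) (σ z) →
        Adj G (σ y) (σ j)
      farRight-adj-j {y} {z} farY z<i z~t y~z = close⇒adj y≢j (ℚ.<⇒≤ y<j+1) (ℚ.<⇒≤ j<y+1)
        where
        y≢j : σ y ≢ σ j
        y≢j y≡j = farRight⇒≁t farY (subst (Adj G t) (sym y≡j) t~j)
        z≤i+1 : f (σ z) ℚ.≤ f (σ i) + 1ℚ
        z≤i+1 = proj₁ (adj⇒close (leftOf-t⇒label⊇t i<last i<t z<i z~t))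
        y<j+1 : f (σ y) ℚ.< f (σ j) + 1ℚ
        y<j+1 = ℚ.≤-<-trans (ℚ.≤-trans (proj₁ (adj⇒close y~z)) (+1-mono-≤ z≤i+1)) (+1-mono-< gap)
        j<y+1 : f (σ j) ℚ.< f (σ y) + 1ℚ
        j<y+1 = ℚ.≤-<-trans (proj₂ (adj⇒close t~j)) (ℚ.<-trans farY (<+1 (f (σ y))))
      violation : (∃₂ λ y z → y < i × z < i × FarRight f t (σ y) × Adj G (σ z) t × Adj G (σ y) (σ z)) → ⊥
      violation (y , z , y<i , z<i , farY , z~t , y~z) =
        mns i j i<j (i⊆j , y , y<i , farRight-adj-j farY z<i z~t y~z ,
                     leftOf-t-≁-farRight (ℚ.<⇒≤ i<t) farY ∘ adj-sym G)

    noMinimalBad : ∀ {i} → Minimal (Bad ∘ σ) i → ⊥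
    noMinimalBad {i} ((t~i , w , t~w , i≢w , i≁w) , noBadBefore) with position w | σ-position w
    ... | j | refl with Fin.<-cmp i j
    ...   | tri≈ _ refl _ = i≢w refl
    ...   | tri> _ _ j<i  = noBadBefore j j<i (t~w , σ i , t~i , i≢w ∘ sym , i≁w ∘ adj-sym G)
    ...   | tri< i<j _ _ with σ≢t⇒<last (adj⇒≢ G t~w ∘ sym) | f (σ j) ℚ.<? f t | f (σ i) ℚ.<? f t
    ...     | j<last | yes j<t | _       = i≁w (leftOf-t⇒label⊇t j<last j<t i<j (adj-sym G t~i))
    ...     | j<last | no  t≤j | yes i<t = ¬leftRight-nonEdge i<j j<last noBadBefore t~i t~w i<t (ℚ.≮⇒≥ t≤j) i≁w
    ...     | _      | no  t≤j | no  t≤i = i≁w (rightOf-t-adj i≢w (ℚ.≮⇒≥ t≤i) (ℚ.≮⇒≥ t≤j) t~i t~w)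

    simplicial : Simplicial G t
    simplicial u w t~u t~w u≢w = ¬bad⇒adj ¬bad t~u t~w u≢w
      where
      ¬bad : ¬ Bad u
      ¬bad bad = noMinimalBad (proj₂ (minimal (bad? ∘ σ) (subst Bad (sym (σ-position u)) bad)))

    condition : Simplicial G t × ConnectedMinusClosedNbhd G t
    condition = simplicial , connectedOutside noFarLeft connected


module Characterisation {n} {G : Graph n} {f : Fin n → ℚ} (rep : Representation G f) (connected : Connected G)
  (t : Fin n) where

  open UnitIntervals rep t using (farLeft?; farRight?; farLeft∩farRight; outside-separated)
  open Mirror f t

  rep⁻ : Representation G (-_ ∘ f)
  rep⁻ = neg-representation rep

  condition⇒uio : Simplicial G t × ConnectedMinusClosedNbhd G t →
    Σ (Ordering G) λ o → IsUnitIntervalOrder G o × LastVertex G o t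
  condition⇒uio (simplicial , connectedOutside) with Fin.any? farRight?
  ... | no  noFarRight = UnitIntervals.tLastOrdering rep t simplicial (λ v farR → noFarRight (v , farR))
  ... | yes (r , farR) = UnitIntervals.tLastOrdering rep⁻ t simplicial
    (λ v farR⁻ → outside-separated connectedOutside (farRight⁻⇒farLeft farR⁻) farR)

  mns⇒condition : Σ (Ordering G) (λ o → IsMNSOrdering G o × LastVertex G o t) →
    Simplicial G t × ConnectedMinusClosedNbhd G t
  mns⇒condition ((σ , σ-injective) , mns , last , last≡n , σlast≡t) =
    bySides (Fin.any? farLeft?) (Fin.any? farRight?)
    where
    open MNSStructure G connected σ σ-injective mns using (σ-position)
    module L  = LastOfMNS rep  connected σ σ-injective mns last≡n σlast≡t
    module L⁻ = LastOfMNS rep⁻ connected σ σ-injective mns last≡n σlast≡t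
    firstFarLeft-vs-firstFarRight : ∃ (Minimal (FarLeft f t ∘ σ)) → ∃ (Minimal (FarRight f t ∘ σ)) → ⊥
    firstFarLeft-vs-firstFarRight (kL , farKL , noFarLeftBefore) (kR , farKR , noFarRightBefore)
      with Fin.<-cmp kL kR
    ... | tri< kL<kR _ _ = L.farLeft-before-farRight farKR noFarRightBefore farKL kL<kR
    ... | tri≈ _ refl _  = farLeft∩farRight farKL farKR
    ... | tri> _ _ kR<kL = L⁻.farLeft-before-farRight (farLeft⇒farRight⁻ farKL)
                             (λ j j<kL → noFarLeftBefore j j<kL ∘ farRight⁻⇒farLeft) (farRight⇒farLeft⁻ farKR) kR<kL
    bySides : Dec (∃ (FarLeft f t)) → Dec (∃ (FarRight f t)) → Simplicial G t × ConnectedMinusClosedNbhd G t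
    bySides (no noFarLeft)   _                = L.condition (λ v farL → noFarLeft (v , farL))
    bySides (yes _)          (no noFarRight)  = L⁻.condition (λ v farL⁻ → noFarRight (v , farLeft⁻⇒farRight farL⁻))
    bySides (yes (l , farL)) (yes (r , farR)) = ⊥-elim (firstFarLeft-vs-firstFarRight
      (minimal (farLeft? ∘ σ) (subst (FarLeft f t) (sym (σ-position l)) farL))
      (minimal (farRight? ∘ σ) (subst (FarRight f t) (sym (σ-position r)) farR)))

theorem17 : (n : ℕ) (G : Graph n) → IsUnitIntervalGraph G → Connected G → (t : Fin n) →
    ((Simplicial G t × ConnectedMinusClosedNbhd G t) ⇔ Σ (Ordering G) (λ σ → IsUnitIntervalOrder G σ × LastVertex G σ t))
    × ((Simplicial G t × ConnectedMinusClosedNbhd G t) ⇔ Σ (Ordering G) (λ σ → IsMNSOrdering G σ × LastVertex G σ t))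
    × (Σ (Ordering G) (λ σ → IsMNSOrdering G σ × LastVertex G σ t) ⇔ Σ (Ordering G) (λ σ → IsMCSOrdering G σ × LastVertex G σ t))
    × (Σ (Ordering G) (λ σ → IsMNSOrdering G σ × LastVertex G σ t) ⇔ Σ (Ordering G) (λ σ → IsLDFSOrdering G σ × LastVertex G σ t))
theorem17 n G (f , rep) connected t =
  mk⇔ condition⇒uio (mns⇒condition ∘ mapLastVertex G (uio⇒mns G)) ,
  mk⇔ (mapLastVertex G (uio⇒mns G) ∘ condition⇒uio) mns⇒condition ,
  mk⇔ (mapLastVertex G (uio⇒mcs G) ∘ condition⇒uio ∘ mns⇒condition) (mapLastVertex G (mcs⇒mns G)) ,
  mk⇔ (mapLastVertex G (uio⇒ldfs G t) ∘ condition⇒uio ∘ mns⇒condition) (mapLastVertex G (ldfs⇒mns G))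
  where
  representation : Representation G f
  representation = record { adj⇔close = rep }
  open Characterisation representation connected t
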